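{- The variety $\mathbf{DmsSt}$ of dually ms Stone semi-Heyting algebras is at level $2$; that is, every dually ms Stone semi-Heyting algebra satisfies the identity $t_2(x)\approx t_3(x)$.
   Context: A semi-Heyting algebra is an algebra $\langle L,\vee,\wedge,\to,0,1\rangle$ such that $\langle L,\vee,\wedge,0,1\rangle$ is a bounded lattice and the identities $x\wedge(x\to y)\approx x\wedge y$, $x\wedge(y\to z)\approx x\wedge[(x\wedge y)\to(x\wedge z)]$, and $x\to x\approx 1$ hold; $x^* := x\to 0$ is the pseudocomplement. A dually quasi-De Morgan semi-Heyting algebra is an algebra $\langle L,\vee,\wedge,\to,{}',0,1\rangle$ whose reduct $\langle L,\vee,\wedge,\to,0,1\rangle$ is a semi-Heyting algebra and which satisfies $0'\approx 1$, $1'\approx 0$, $(x\wedge y)'\approx x'\vee y'$, $(x\vee y)''\approx x''\vee y''$, and $x''\le x$. A dually ms Stone semi-Heyting algebra is a dually quasi-De Morgan semi-Heyting algebra that additionally satisfies $(x\vee y)'\approx x'\wedge y'$ and the Stone identity $x^*\vee x^{**}\approx 1$. Define $x^{0('^*)} := x$, $x^{(k+1)('^*)} := ((x^{k('^*)})')^*$, $t_0(x):=x$, $t_{k+1}(x):=t_k(x)\wedge x^{(k+1)('^*)}$. A variety is at level $n$ if it satisfies $t_n(x)\approx t_{n+1}(x)$. -}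

module Defs where

open import Level using (Level; suc)
open import Relation.Binary.PropositionalEquality using (_≡_)
open import Algebra.Core using (Op₁; Op₂)
open import Algebra.Definitions using (LeftIdentity)
open import Algebra.Lattice.Structures using (IsLattice)
open import Data.Nat using (ℕ; zero) renaming (suc to 1+)

record DmsStoneSH (a : Level) : Set (suc a) where
  infixr 6 _∨_
  infixr 7 _∧_
  infixr 5 _⇒_
  field
    Carrier : Set a
    _∨_ _∧_ _⇒_ : Op₂ Carrier
    _′ : Op₁ Carrier
    𝟘 𝟙 : Carrier
    isLattice : IsLattice _≡_ _∨_ _∧_
    𝟘-least : ∀ x → 𝟘 ∨ x ≡ x
    𝟙-greatest : ∀ x → 𝟙 ∧ x ≡ x
  _≤_ : Carrier → Carrier → Set a
  x ≤ y = x ∧ y ≡ x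
  _* : Op₁ Carrier
  x * = x ⇒ 𝟘
  field
    SH1 : ∀ x y → x ∧ (x ⇒ y) ≡ x ∧ y
    SH2 : ∀ x y z → x ∧ (y ⇒ z) ≡ x ∧ ((x ∧ y) ⇒ (x ∧ z))
    SH3 : ∀ x → x ⇒ x ≡ 𝟙
    DQD1 : 𝟘 ′ ≡ 𝟙
    DQD2 : 𝟙 ′ ≡ 𝟘
    DQD3 : ∀ x y → (x ∧ y) ′ ≡ x ′ ∨ y ′
    DQD4 : ∀ x y → ((x ∨ y) ′) ′ ≡ (x ′) ′ ∨ (y ′) ′
    DQD5 : ∀ x → ((x ′) ′) ≤ x
    DMS : ∀ x y → (x ∨ y) ′ ≡ x ′ ∧ y ′
    Stone : ∀ x → x * ∨ (x *) * ≡ 𝟙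

  iter′* : ℕ → Carrier → Carrier
  iter′* zero x = x
  iter′* (1+ k) x = (iter′* k x ′) *

  t : ℕ → Carrier → Carrier
  t zero x = x
  t (1+ k) x = t k x ∧ iter′* (1+ k) x

module Submission where

-- Write A = x^{1('*)} = (x′)*.  By the Stone identity A has a complement,
-- namely A*.  Two facts about complemented elements c (with complement d)
-- drive the proof:
--   * the operation ′ maps complements to complements (this is where the
--     dually ms law (u ∨ v)′ = u′ ∧ v′ is used), and complements are unique
--     because the lattice is distributive, so (c′)* = d′;
--   * c′′ = c.
-- Hence x^{2('*)} = (A′)* = (A*)′ and x^{3('*)} = ((A*)′′)* = A′′ = A, so the
-- sequence x^{k('*)} is periodic from k = 1 on, and t₃(x) = t₂(x) ∧ A = t₂(x)
-- because t₂(x) ≤ A.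

open import Defs
open import Level using (Level)
open import Data.Nat using (zero; suc; _+_)
open import Data.Product using (_,_)
open import Relation.Binary.PropositionalEquality using (_≡_; sym; trans; cong; module ≡-Reasoning)
open import Algebra.Lattice.Bundles using (Lattice)
import Algebra.Lattice.Properties.Lattice as LatticeProperties
open import Relation.Binary.Lattice using (HeytingAlgebra)
import Relation.Binary.Lattice.Properties.HeytingAlgebra as HeytingProperties
import Relation.Binary.Lattice.Properties.MeetSemilattice as MeetProperties
import Relation.Binary.Lattice.Properties.BoundedLattice as BoundedLatticeProperties
import Relation.Binary.Lattice.Properties.BoundedJoinSemilattice as BoundedJoinProperties

module DmsStoneProperties {a : Level} (L : DmsStoneSH a) where
  open DmsStoneSH L hiding (_≤_)
  open ≡-Reasoning

  lattice : Lattice a a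
  lattice = record { isLattice = isLattice }

  open LatticeProperties lattice using (∧-idem; ∨-∧-isOrderTheoreticLattice)
  open Lattice lattice using (∧-comm; ∧-assoc; ∨-comm; ∧-absorbs-∨)

  -- The natural order of the lattice, x ≤ y iff x = x ∧ y (the same relation as
  -- DmsStoneSH._≤_ read right to left, as the standard library orients it).
  infix 4 _≤_
  _≤_ : Carrier → Carrier → Set a
  x ≤ y = x ≡ x ∧ y

  -- In a semi-Heyting algebra, y ↦ x ⇒ (x ∧ y) is right adjoint to x ∧ _:
  -- w ∧ x ≤ y  iff  w ≤ x ⇒ (x ∧ y).
  _⇨_ : Carrier → Carrier → Carrier
  x ⇨ y = x ⇒ (x ∧ y)

  ⇨-intro : ∀ w x y → w ∧ x ≤ y → w ≤ x ⇨ y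
  ⇨-intro w x y w∧x≤y = sym (begin
    w ∧ (x ⇒ (x ∧ y))              ≡⟨ SH2 w x (x ∧ y) ⟩
    w ∧ ((w ∧ x) ⇒ (w ∧ (x ∧ y)))  ≡⟨ cong (λ v → w ∧ ((w ∧ x) ⇒ v)) (sym (∧-assoc w x y)) ⟩
    w ∧ ((w ∧ x) ⇒ ((w ∧ x) ∧ y))  ≡⟨ cong (λ v → w ∧ ((w ∧ x) ⇒ v)) (sym w∧x≤y) ⟩
    w ∧ ((w ∧ x) ⇒ (w ∧ x))        ≡⟨ cong (w ∧_) (SH3 (w ∧ x)) ⟩
    w ∧ 𝟙                          ≡⟨ ∧-comm w 𝟙 ⟩
    𝟙 ∧ w                          ≡⟨ 𝟙-greatest w ⟩
    w                              ∎)

  ⇨-elim : ∀ w x y → w ≤ x ⇨ y → w ∧ x ≤ y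
  ⇨-elim w x y w≤x⇨y = begin
    w ∧ x                          ≡⟨ cong (_∧ x) w≤x⇨y ⟩
    (w ∧ (x ⇒ (x ∧ y))) ∧ x        ≡⟨ ∧-assoc w _ x ⟩
    w ∧ ((x ⇒ (x ∧ y)) ∧ x)        ≡⟨ cong (w ∧_) (∧-comm _ x) ⟩
    w ∧ (x ∧ (x ⇒ (x ∧ y)))        ≡⟨ cong (w ∧_) (SH1 x (x ∧ y)) ⟩
    w ∧ (x ∧ (x ∧ y))              ≡⟨ cong (w ∧_) (sym (∧-assoc x x y)) ⟩
    w ∧ ((x ∧ x) ∧ y)              ≡⟨ cong (λ v → w ∧ (v ∧ y)) (∧-idem x) ⟩
    w ∧ (x ∧ y)                    ≡⟨ sym (∧-assoc w x y) ⟩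
    (w ∧ x) ∧ y                    ∎

  heytingAlgebra : HeytingAlgebra a a a
  heytingAlgebra = record
    { isHeytingAlgebra = record
      { isBoundedLattice = record
        { isLattice = ∨-∧-isOrderTheoreticLattice
        ; maximum   = λ x → sym (trans (∧-comm x 𝟙) (𝟙-greatest x))
        ; minimum   = λ x → sym (trans (cong (𝟘 ∧_) (sym (𝟘-least x))) (∧-absorbs-∨ 𝟘 x))
        }
      ; exponential = λ w x y → ⇨-intro w x y , ⇨-elim w x y
      }
    }

  open HeytingAlgebra heytingAlgebra
    using (antisym; maximum; x∧y≤x; x∧y≤y; meetSemilattice; boundedLattice; boundedJoinSemilattice)
    renaming (refl to ≤-refl; trans to ≤-trans)
  -- Heyting algebras are distributive.
  open HeytingProperties heytingAlgebra using (∧-distribˡ-∨)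
  open MeetProperties meetSemilattice using (∧-monotonic)
  open BoundedLatticeProperties boundedLattice using (∧-zeroʳ)
  open BoundedJoinProperties boundedJoinSemilattice using (identityˡ; identityʳ)

  *-disjoint : ∀ x → x ∧ x * ≡ 𝟘
  *-disjoint x = trans (SH1 x 𝟘) (∧-zeroʳ x)

  *-greatest : ∀ {w x} → w ∧ x ≡ 𝟘 → w ≤ x *
  *-greatest {w} {x} w∧x≡𝟘 = trans (⇨-intro w x 𝟘 (trans w∧x≡𝟘 (sym (∧-zeroʳ (w ∧ x)))))
                                  (cong (λ v → w ∧ (x ⇒ v)) (∧-zeroʳ x))

  record Complement (c d : Carrier) : Set a where
    field
      disjoint : c ∧ d ≡ 𝟘
      covering : c ∨ d ≡ 𝟙
  open Complement

  complement-sym : ∀ {c d} → Complement c d → Complement d c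
  complement-sym {c} {d} k = record
    { disjoint = trans (∧-comm d c) (disjoint k)
    ; covering = trans (∨-comm d c) (covering k)
    }

  complement⇒* : ∀ {c d} → Complement c d → c * ≡ d
  complement⇒* {c} {d} k = antisym c*≤d (*-greatest (trans (∧-comm d c) (disjoint k)))
    where
    c*≤d : c * ≤ d
    c*≤d = begin
      c *                    ≡⟨ maximum (c *) ⟩
      c * ∧ 𝟙                ≡⟨ cong (c * ∧_) (sym (covering k)) ⟩
      c * ∧ (c ∨ d)          ≡⟨ ∧-distribˡ-∨ (c *) c d ⟩
      (c * ∧ c) ∨ (c * ∧ d)  ≡⟨ cong (_∨ (c * ∧ d)) (trans (∧-comm (c *) c) (*-disjoint c)) ⟩
      𝟘 ∨ (c * ∧ d)          ≡⟨ identityˡ (c * ∧ d) ⟩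
      c * ∧ d                ∎

  stone-complement : ∀ y → Complement (y *) (y * *)
  stone-complement y = record { disjoint = *-disjoint (y *) ; covering = Stone y }

  -- The dual operation ′ preserves complements: ′ turns ∧ into ∨ (dually
  -- quasi-De Morgan) and ∨ into ∧ (dually ms), and swaps 𝟘 and 𝟙.
  complement-′ : ∀ {c d} → Complement c d → Complement (c ′) (d ′)
  complement-′ {c} {d} k = record
    { disjoint = trans (sym (DMS c d)) (trans (cong _′ (covering k)) DQD2)
    ; covering = trans (sym (DQD3 c d)) (trans (cong _′ (disjoint k)) DQD1)
    }

  complement-′* : ∀ {c d} → Complement c d → (c ′) * ≡ d ′
  complement-′* k = complement⇒* (complement-′ k)

  -- Complemented elements are fixed by ′′.  One inequality is the axiom
  -- x′′ ≤ x; for the other, c′′ and d′′ are complements with d′′ ≤ d.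
  complement-′′ : ∀ {c d} → Complement c d → c ′ ′ ≡ c
  complement-′′ {c} {d} k = antisym (sym (DQD5 c)) c≤c′′
    where
    c∧d′′≡𝟘 : c ∧ d ′ ′ ≡ 𝟘
    c∧d′′≡𝟘 = begin
      c ∧ d ′ ′                  ≡⟨ ∧-monotonic ≤-refl (sym (DQD5 d)) ⟩
      (c ∧ d ′ ′) ∧ (c ∧ d)      ≡⟨ cong ((c ∧ d ′ ′) ∧_) (disjoint k) ⟩
      (c ∧ d ′ ′) ∧ 𝟘            ≡⟨ ∧-zeroʳ _ ⟩
      𝟘                          ∎
    c≤c′′ : c ≤ c ′ ′
    c≤c′′ = begin
      c                                ≡⟨ maximum c ⟩
      c ∧ 𝟙                            ≡⟨ cong (c ∧_) (sym (covering (complement-′ (complement-′ k)))) ⟩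
      c ∧ (c ′ ′ ∨ d ′ ′)              ≡⟨ ∧-distribˡ-∨ c _ _ ⟩
      (c ∧ c ′ ′) ∨ (c ∧ d ′ ′)        ≡⟨ cong ((c ∧ c ′ ′) ∨_) c∧d′′≡𝟘 ⟩
      (c ∧ c ′ ′) ∨ 𝟘                  ≡⟨ identityʳ (c ∧ c ′ ′) ⟩
      c ∧ c ′ ′                        ∎

  -- The sequence x^{k('*)} is periodic from k = 1 on with period 2:
  -- with A = (x′)* and its complement A*, x^{2('*)} = (A*)′ and therefore
  -- x^{3('*)} = ((A*)′′)* = A′′ = A.
  iter′*-period : ∀ x → iter′* 3 x ≡ iter′* 1 x
  iter′*-period x = begin
    (iter′* 2 x ′) *    ≡⟨ cong (λ v → (v ′) *) (complement-′* A-complement) ⟩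
    ((A * ′) ′) *       ≡⟨ complement-′* (complement-′ (complement-sym A-complement)) ⟩
    A ′ ′               ≡⟨ complement-′′ A-complement ⟩
    A                   ∎
    where
    A : Carrier
    A = iter′* 1 x
    A-complement : Complement A (A *)
    A-complement = stone-complement (x ′)

  t-below-last : ∀ m x → t m x ≤ iter′* m x
  t-below-last zero    x = ≤-refl
  t-below-last (suc m) x = x∧y≤y (t m x) (iter′* (suc m) x)

  t-below : ∀ k m x → t (k + m) x ≤ iter′* m x
  t-below zero    m x = t-below-last m x
  t-below (suc k) m x = ≤-trans (x∧y≤x (t (k + m) x) _) (t-below k m x)

theorem4p8 : ∀ {a : Level} (L : DmsStoneSH a) (x : DmsStoneSH.Carrier L) →
    DmsStoneSH.t L 2 x ≡ DmsStoneSH.t L 3 x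
theorem4p8 L x = sym (begin
  t 2 x ∧ iter′* 3 x  ≡⟨ cong (t 2 x ∧_) (iter′*-period x) ⟩
  t 2 x ∧ iter′* 1 x  ≡⟨ sym (t-below 1 1 x) ⟩
  t 2 x               ∎)
  where
  open DmsStoneSH L using (_∧_; t; iter′*)
  open DmsStoneProperties L using (iter′*-period; t-below)
  open ≡-Reasoning
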